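{- Let $G$ be a graph containing an $H$-graph $H^*$ (possibly tight or semi-tight) as a (not necessarily induced) subgraph such that the body of $H^*$ induces a chordless path in $G$, and let $s\ge 2$ be an integer. Then either (1) $G$ contains a path of length $t\in\{2,\ldots,s+1\}$ connecting a left wing of $H^*$ to a right wing of $H^*$ with all intermediate vertices lying in the body of $H^*$, or (2) $G$ contains a canonical graph of order at least $s$ as an induced subgraph.
   Context: All graphs are finite, simple, undirected. For $i\ge 1$, $H_i$ is the graph obtained from a path $u_0u_1\cdots u_i$ (with $i$ edges) by attaching two pendant vertices to $u_0$ and two pendant vertices to $u_i$. $H'_i$ is obtained from $H_i$ by adding an edge between the two pendant vertices attached to one end of the path ($H_i$ is semi-tight), and $H''_i$ by adding edges between both pairs ($H''_i$ is tight). An $H$-graph is any graph of the form $H_i$, $H'_i$ or $H''_i$; the path $u_0\cdots u_i$ is its body and the four other vertices are its wings; the two wings adjacent to one end of the body are the left wings and the two adjacent to the other end are the right wings. A hole is a chordless cycle of length at least four. A canonical graph is a hole or an $H$-graph; its order is its number of vertices if it is a hole, and the number of vertices of its body if it is an $H$-graph. -}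

module Defs where

open import Data.Nat using (ℕ; zero; suc; _≤_; _<_; _≡ᵇ_)
open import Data.Bool using (Bool; true; false; _∧_; _∨_)
import Data.Fin
open import Data.Fin using (Fin; toℕ; inject₁; fromℕ)
open import Data.Product using (Σ; ∃; ∃-syntax; _×_; _,_)
open import Data.Sum using (_⊎_)
open import Function.Definitions using (Injective)
open import Relation.Binary.PropositionalEquality using (_≡_)

record Graph (n : ℕ) : Set where
  field
    adj    : Fin n → Fin n → Bool
    sym    : ∀ x y → adj x y ≡ adj y x
    irrefl : ∀ x → adj x x ≡ false
open Graph public

data Wing : Set where
  L₁ L₂ R₁ R₂ : Wing

data HV (i : ℕ) : Set where
  body : Fin (suc i) → HV i
  wing : Wing → HV i

wingAt : (i : ℕ) → Wing → Fin (suc i) → Bool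
wingAt i L₁ j = toℕ j ≡ᵇ 0
wingAt i L₂ j = toℕ j ≡ᵇ 0
wingAt i R₁ j = toℕ j ≡ᵇ i
wingAt i R₂ j = toℕ j ≡ᵇ i

-- lt / rt : whether the left / right wings are joined by an edge
-- (false,false = H_i ; exactly one true = H'_i ; both true = H''_i)
wingAdj : Bool → Bool → Wing → Wing → Bool
wingAdj lt rt L₁ L₂ = lt
wingAdj lt rt L₂ L₁ = lt
wingAdj lt rt R₁ R₂ = rt
wingAdj lt rt R₂ R₁ = rt
wingAdj lt rt _  _  = false

pathAdj : {m : ℕ} → Fin m → Fin m → Bool
pathAdj j k = (suc (toℕ j) ≡ᵇ toℕ k) ∨ (suc (toℕ k) ≡ᵇ toℕ j)

HAdj : (i : ℕ) → Bool → Bool → HV i → HV i → Bool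
HAdj i lt rt (body j) (body k) = pathAdj j k
HAdj i lt rt (body j) (wing w) = wingAt i w j
HAdj i lt rt (wing w) (body j) = wingAt i w j
HAdj i lt rt (wing w) (wing w') = wingAdj lt rt w w'

cycAdj : (k : ℕ) → Fin k → Fin k → Bool
cycAdj k a b = pathAdj a b
  ∨ ((toℕ a ≡ᵇ 0) ∧ (suc (toℕ b) ≡ᵇ k))
  ∨ ((toℕ b ≡ᵇ 0) ∧ (suc (toℕ a) ≡ᵇ k))

IsHSubgraph : {n : ℕ} → Graph n → (i : ℕ) → Bool → Bool → (HV i → Fin n) → Set
IsHSubgraph G i lt rt f =
  Injective _≡_ _≡_ f ×
  (∀ x y → HAdj i lt rt x y ≡ true → adj G (f x) (f y) ≡ true)

BodyChordless : {n : ℕ} → Graph n → (i : ℕ) → (HV i → Fin n) → Set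
BodyChordless G i f =
  ∀ j k → adj G (f (body j)) (f (body k)) ≡ pathAdj j k

IsInducedH : {n : ℕ} → Graph n → (i : ℕ) → Bool → Bool → (HV i → Fin n) → Set
IsInducedH G i lt rt f =
  Injective _≡_ _≡_ f × (∀ x y → adj G (f x) (f y) ≡ HAdj i lt rt x y)

IsInducedHole : {n : ℕ} → Graph n → (k : ℕ) → (Fin k → Fin n) → Set
IsInducedHole G k g =
  4 ≤ k × Injective _≡_ _≡_ g × (∀ a b → adj G (g a) (g b) ≡ cycAdj k a b)

HasCanonicalInduced : {n : ℕ} → Graph n → ℕ → Set
HasCanonicalInduced {n} G s =
  (Σ ℕ λ k → Σ (Fin k → Fin n) λ g → s ≤ k × IsInducedHole G k g)
  ⊎
  (Σ ℕ λ i → Σ Bool λ lt → Σ Bool λ rt → Σ (HV i → Fin n) λ f →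
     1 ≤ i × s ≤ suc i × IsInducedH G i lt rt f)

IsPath : {n : ℕ} → Graph n → (t : ℕ) → (Fin (suc t) → Fin n) → Set
IsPath G t p =
  Injective _≡_ _≡_ p × (∀ (a : Fin t) → adj G (p (inject₁ a)) (p (Data.Fin.suc a)) ≡ true)

HasWingPath : {n : ℕ} → Graph n → (i : ℕ) → (HV i → Fin n) → ℕ → Set
HasWingPath {n} G i f s =
  Σ ℕ λ t → Σ (Fin (suc t) → Fin n) λ p →
    2 ≤ t × t ≤ suc s × IsPath G t p ×
    ((p Data.Fin.zero ≡ f (wing L₁)) ⊎ (p Data.Fin.zero ≡ f (wing L₂))) ×
    ((p (fromℕ t) ≡ f (wing R₁)) ⊎ (p (fromℕ t) ≡ f (wing R₂))) ×
    (∀ (a : Fin (suc t)) → 0 < toℕ a → toℕ a < t →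
       ∃[ j ] (p a ≡ f (body j)))

-- Let u₀ … uᵢ be the body. Take the first body vertex u_k seen by a right wing y,
-- and the last body vertex u_j with j ≤ k seen by a left wing x. Then x only sees
-- u_j and y only sees u_k on the window u_j … u_k, so x u_j … u_k y is a path of
-- length k − j + 2; if that is at most s + 1 we are done. Otherwise the window has
-- at least s vertices, and each end carries two distinct pendant vertices: the two
-- wings of H* if the window reaches the end of the body, and otherwise the wing
-- x (resp. y) together with the next body vertex. A left and a right pendant that
-- are adjacent close a hole of length k − j + 3; if no two are adjacent, the window
-- and its four pendants induce an H-graph.

module Submission where

open import Defs
open import Data.Bool using (Bool; true; false; _∧_; _∨_)
open import Data.Bool.Properties using (∨-identityʳ; ∨-comm; ∨-conicalˡ; ∨-conicalʳ)
open import Data.Empty using (⊥-elim)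
open import Data.Fin using (Fin; toℕ; fromℕ; fromℕ<)
open import Data.Fin.Properties using (toℕ-injective; toℕ<n; toℕ-inject₁; toℕ-fromℕ; toℕ-fromℕ<)
open import Data.Nat using (ℕ; zero; suc; _≤_; _<_; _+_; _≡ᵇ_; z≤n; s≤s; _≤?_; _<?_; _≟_)
open import Data.Nat.Properties
open import Data.Product using (Σ; ∃-syntax; _×_; _,_)
open import Data.Sum using (_⊎_; inj₁; inj₂)
open import Function.Definitions using (Injective)
open import Relation.Binary.PropositionalEquality
  using (_≡_; _≢_; refl; trans; cong; cong₂; subst) renaming (sym to ≡-sym)
open import Relation.Nullary using (¬_; yes; no)
open import Relation.Nullary.Decidable using (dec-true; dec-false)

≡ᵇ-refl : ∀ m → (m ≡ᵇ m) ≡ true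
≡ᵇ-refl m = dec-true (m ≟ m) refl

≢⇒≡ᵇ-false : ∀ {m n} → m ≢ n → (m ≡ᵇ n) ≡ false
≢⇒≡ᵇ-false {m} {n} = dec-false (m ≟ n)

pathAdjℕ : ℕ → ℕ → Bool
pathAdjℕ r r' = (suc r ≡ᵇ r') ∨ (suc r' ≡ᵇ r)

pathAdjℕ-comm : ∀ r r' → pathAdjℕ r r' ≡ pathAdjℕ r' r
pathAdjℕ-comm r r' = ∨-comm (suc r ≡ᵇ r') (suc r' ≡ᵇ r)

pathAdjℕ-irrefl : ∀ r → pathAdjℕ r r ≡ false
pathAdjℕ-irrefl zero    = refl
pathAdjℕ-irrefl (suc r) = pathAdjℕ-irrefl r

pathAdjℕ-suc : ∀ r → pathAdjℕ r (suc r) ≡ true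
pathAdjℕ-suc r rewrite ≡ᵇ-refl r = refl

pathAdjℕ-+ : ∀ j r r' → pathAdjℕ (j + r) (j + r') ≡ pathAdjℕ r r'
pathAdjℕ-+ zero    r r' = refl
pathAdjℕ-+ (suc j) r r' = pathAdjℕ-+ j r r'

pathAdjℕ-pred : ∀ j r → pathAdjℕ j (suc j + r) ≡ (r ≡ᵇ 0)
pathAdjℕ-pred zero    zero    = refl
pathAdjℕ-pred zero    (suc r) = refl
pathAdjℕ-pred (suc j) r       = pathAdjℕ-pred j r

pathAdjℕ-succ : ∀ j {r D} → r ≤ D → pathAdjℕ (suc (j + D)) (j + r) ≡ (r ≡ᵇ D)
pathAdjℕ-succ zero    z≤n     = refl
pathAdjℕ-succ zero    (s≤s h) = pathAdjℕ-succ zero h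
pathAdjℕ-succ (suc j) h       = pathAdjℕ-succ j h

no-vertex-adjacent-only-to-start :
  ∀ {r D} → 2 ≤ D → r ≤ D → ¬ (∀ {r'} → r' ≤ D → pathAdjℕ r r' ≡ (r' ≡ᵇ 0))
no-vertex-adjacent-only-to-start {zero} _ _ only with only z≤n
... | ()
no-vertex-adjacent-only-to-start {suc zero} 2≤D _ only with only 2≤D
... | ()
no-vertex-adjacent-only-to-start {suc (suc r)} _ _ only with only z≤n
... | ()

no-vertex-adjacent-only-to-end :
  ∀ {r D} → 2 ≤ D → r ≤ D → ¬ (∀ {r'} → r' ≤ D → pathAdjℕ r r' ≡ (r' ≡ᵇ D))
no-vertex-adjacent-only-to-end {zero} {suc (suc D)} (s≤s (s≤s _)) _ only
  with trans (only ≤-refl) (≡ᵇ-refl D)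
... | ()
no-vertex-adjacent-only-to-end {suc r} _ r<D only
  with trans (≡-sym (trans (pathAdjℕ-comm (suc r) r) (pathAdjℕ-suc r)))
             (trans (only (≤-trans (n≤1+n r) r<D)) (≢⇒≡ᵇ-false (<⇒≢ r<D)))
... | ()

cycAdjℕ : ℕ → ℕ → ℕ → Bool
cycAdjℕ K m m' = pathAdjℕ m m' ∨ ((m ≡ᵇ 0) ∧ (suc m' ≡ᵇ K)) ∨ ((m' ≡ᵇ 0) ∧ (suc m ≡ᵇ K))

cycAdjℕ-comm : ∀ K m m' → cycAdjℕ K m m' ≡ cycAdjℕ K m' m
cycAdjℕ-comm K m m' =
  cong₂ _∨_ (pathAdjℕ-comm m m') (∨-comm ((m ≡ᵇ 0) ∧ (suc m' ≡ᵇ K)) _)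

cycAdjℕ-inner : ∀ K r r' → cycAdjℕ K (suc r) (suc r') ≡ pathAdjℕ r r'
cycAdjℕ-inner K r r' = ∨-identityʳ (pathAdjℕ r r')

cycAdjℕ-start-inner : ∀ {r D} → r ≤ D → cycAdjℕ (3 + D) 0 (suc r) ≡ (r ≡ᵇ 0)
cycAdjℕ-start-inner {zero}  _ = refl
cycAdjℕ-start-inner {suc r} r<D rewrite ≢⇒≡ᵇ-false (<⇒≢ r<D) = refl

cycAdjℕ-start-end : ∀ D → cycAdjℕ (3 + D) 0 (2 + D) ≡ true
cycAdjℕ-start-end D rewrite ≡ᵇ-refl D = refl

cycAdjℕ-inner-end : ∀ {r D} → r ≤ D → cycAdjℕ (3 + D) (suc r) (2 + D) ≡ (r ≡ᵇ D)
cycAdjℕ-inner-end {r} {D} h =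
  trans (∨-identityʳ _) (trans (pathAdjℕ-comm r (suc D)) (pathAdjℕ-succ zero h))

cycAdjℕ-end-end : ∀ D → cycAdjℕ (3 + D) (2 + D) (2 + D) ≡ false
cycAdjℕ-end-end D = trans (∨-identityʳ _) (pathAdjℕ-irrefl (2 + D))

first-true : (P : ℕ → Bool) (N : ℕ) → P N ≡ true →
             Σ ℕ λ k → k ≤ N × P k ≡ true × (∀ {r} → r < k → P r ≡ false)
first-true P zero PN = 0 , z≤n , PN , λ ()
first-true P (suc N) PN with P 0 in P0
... | true = 0 , z≤n , P0 , λ ()
... | false with first-true (λ r → P (suc r)) N PN
... | k , k≤N , Pk , before =
  suc k , s≤s k≤N , Pk , λ { {zero} _ → P0 ; {suc r} (s≤s r<k) → before r<k }

last-true : (P : ℕ → Bool) (N : ℕ) → P 0 ≡ true →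
            Σ ℕ λ j → j ≤ N × P j ≡ true × (∀ {r} → j < r → r ≤ N → P r ≡ false)
last-true P zero P0 = 0 , z≤n , P0 , λ { {suc _} _ () }
last-true P (suc N) P0 with P (suc N) in PN
... | true = suc N , ≤-refl , PN , λ j<r r≤1+N → ⊥-elim (<⇒≱ j<r r≤1+N)
... | false with last-true P N P0
... | j , j≤N , Pj , after = j , m≤n⇒m≤1+n j≤N , Pj , after′
  where
  after′ : ∀ {r} → j < r → r ≤ suc N → P r ≡ false
  after′ j<r r≤1+N with m≤n⇒m<n∨m≡n r≤1+N
  ... | inj₁ r<1+N = after j<r (≤-pred r<1+N)
  ... | inj₂ refl  = PN

-- Only meaningful for j ≤ i; larger j are sent to i.
clamp : (i j : ℕ) → Fin (suc i)
clamp i j with j <? suc i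
... | yes j<1+i = fromℕ< j<1+i
... | no _      = fromℕ i

toℕ-clamp : ∀ {i j} → j ≤ i → toℕ (clamp i j) ≡ j
toℕ-clamp {i} {j} j≤i with j <? suc i
... | yes j<1+i = toℕ-fromℕ< j<1+i
... | no j≮1+i  = ⊥-elim (j≮1+i (s≤s j≤i))

data IsLeft : Wing → Set where
  l₁ : IsLeft L₁
  l₂ : IsLeft L₂

data IsRight : Wing → Set where
  r₁ : IsRight R₁
  r₂ : IsRight R₂

module ChordlessPaths {n : ℕ} (G : Graph n) where

  infix 7 _~_
  _~_ : Fin n → Fin n → Bool
  x ~ y = adj G x y

  ~-sym : ∀ x y → x ~ y ≡ y ~ x
  ~-sym = sym G

  record IsChordlessPath (V : ℕ → Fin n) (D : ℕ) : Set where
    field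
      adjacency : ∀ {r r'} → r ≤ D → r' ≤ D → V r ~ V r' ≡ pathAdjℕ r r'
      injective : ∀ {r r'} → r ≤ D → r' ≤ D → V r ≡ V r' → r ≡ r'
  open IsChordlessPath public

  restrict : ∀ {V D D'} → D ≤ D' → IsChordlessPath V D' → IsChordlessPath V D
  restrict D≤D' p = record
    { adjacency = λ h h' → adjacency p (≤-trans h D≤D') (≤-trans h' D≤D')
    ; injective = λ h h' → injective p (≤-trans h D≤D') (≤-trans h' D≤D')
    }

  shift : ∀ {V} j {D} → IsChordlessPath V (j + D) → IsChordlessPath (λ r → V (j + r)) D
  shift j p = record
    { adjacency = λ {r} {r'} h h' →
        trans (adjacency p (+-monoʳ-≤ j h) (+-monoʳ-≤ j h')) (pathAdjℕ-+ j r r')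
    ; injective = λ {r} {r'} h h' e →
        +-cancelˡ-≡ j r r' (injective p (+-monoʳ-≤ j h) (+-monoʳ-≤ j h') e)
    }

  Attached : (ℕ → Fin n) → ℕ → Fin n → ℕ → Set
  Attached V D a j = ∀ {r} → r ≤ D → a ~ V r ≡ (r ≡ᵇ j)

  OffPath : (ℕ → Fin n) → ℕ → Fin n → Set
  OffPath V D a = ∀ {r} → r ≤ D → a ≢ V r

  attached-start : ∀ {V D a} → a ~ V 0 ≡ true →
                   (∀ {r} → 0 < r → r ≤ D → a ~ V r ≡ false) → Attached V D a 0
  attached-start touch avoid {zero}  _ = touch
  attached-start touch avoid {suc r} h = avoid (s≤s z≤n) h

  attached-end : ∀ {V D a} → a ~ V D ≡ true →
                 (∀ {r} → r < D → a ~ V r ≡ false) → Attached V D a D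
  attached-end touch avoid {r} h with m≤n⇒m<n∨m≡n h
  ... | inj₁ r<D = trans (avoid r<D) (≡-sym (≢⇒≡ᵇ-false (<⇒≢ r<D)))
  ... | inj₂ refl = trans touch (≡-sym (≡ᵇ-refl r))

  predecessor-attached : ∀ {U N j D} → IsChordlessPath U N → suc j + D ≤ N →
                         Attached (λ r → U (suc j + r)) D (U j) 0
  predecessor-attached {j = j} p h {r} r≤D =
    trans (adjacency p (≤-trans (n≤1+n j) (m+n≤o⇒m≤o (suc j) h))
                       (≤-trans (+-monoʳ-≤ (suc j) r≤D) h))
          (pathAdjℕ-pred j r)

  successor-attached : ∀ {U N j D} → IsChordlessPath U N → suc (j + D) ≤ N →
                       Attached (λ r → U (j + r)) D (U (suc (j + D))) D
  successor-attached {j = j} p h r≤D =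
    trans (adjacency p h (≤-trans (+-monoʳ-≤ j r≤D) (<⇒≤ h))) (pathAdjℕ-succ j r≤D)

  attached-start-off : ∀ {V D a} → IsChordlessPath V D → 2 ≤ D → Attached V D a 0 →
                       OffPath V D a
  attached-start-off p 2≤D att h refl =
    no-vertex-adjacent-only-to-start 2≤D h (λ h' → trans (≡-sym (adjacency p h h')) (att h'))

  attached-end-off : ∀ {V D a} → IsChordlessPath V D → 2 ≤ D → Attached V D a D →
                     OffPath V D a
  attached-end-off p 2≤D att h refl =
    no-vertex-adjacent-only-to-end 2≤D h (λ h' → trans (≡-sym (adjacency p h h')) (att h'))

  ends-distinct : ∀ {V D a b} → 1 ≤ D → Attached V D a 0 → Attached V D b D → a ≢ b
  ends-distinct (s≤s _) a-att b-att refl with trans (≡-sym (a-att z≤n)) (b-att z≤n)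
  ... | ()

  module Extension (V : ℕ → Fin n) (D : ℕ) (x y : Fin n) where

    -- x, V 0, …, V D, y (and junk y further on)
    vertex : ℕ → Fin n
    vertex zero = x
    vertex (suc r) with r ≤? D
    ... | yes _ = V r
    ... | no _  = y

    data Slot : ℕ → Set where
      start : Slot 0
      inner : ∀ {r} → r ≤ D → Slot (suc r)
      end   : Slot (suc (suc D))

    slot : ∀ {m} → m ≤ suc (suc D) → Slot m
    slot {zero}  _ = start
    slot {suc r} h with r ≤? D
    ... | yes r≤D = inner r≤D
    ... | no r≰D rewrite ≤-antisym (≤-pred h) (≰⇒> r≰D) = end

    slotOf : (c : Fin (3 + D)) → Slot (toℕ c)
    slotOf c = slot (≤-pred (toℕ<n c))

    at : ∀ {m} → Slot m → Fin n
    at start           = x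
    at (inner {r} _)   = V r
    at end             = y

    vertex-at : ∀ {m} (σ : Slot m) → vertex m ≡ at σ
    vertex-at start = refl
    vertex-at (inner {r} h) with r ≤? D
    ... | yes _  = refl
    ... | no r≰D = ⊥-elim (r≰D h)
    vertex-at end with suc D ≤? D
    ... | yes h = ⊥-elim (1+n≰n h)
    ... | no _  = refl

    via-slots : ∀ {m m' b} (σ : Slot m) (σ' : Slot m') → at σ ~ at σ' ≡ b →
                vertex m ~ vertex m' ≡ b
    via-slots σ σ' e = trans (cong₂ _~_ (vertex-at σ) (vertex-at σ')) e

    vertex-injective : IsChordlessPath V D → x ≢ y → OffPath V D x → OffPath V D y →
                       (c c' : Fin (3 + D)) → vertex (toℕ c) ≡ vertex (toℕ c') → c ≡ c'
    vertex-injective p x≢y x-off y-off c c' e =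
      toℕ-injective (slots (slotOf c) (slotOf c')
        (trans (≡-sym (vertex-at (slotOf c))) (trans e (vertex-at (slotOf c')))))
      where
      slots : ∀ {m m'} (σ : Slot m) (σ' : Slot m') → at σ ≡ at σ' → m ≡ m'
      slots start       start        _ = refl
      slots start       (inner h)    e = ⊥-elim (x-off h e)
      slots start       end          e = ⊥-elim (x≢y e)
      slots (inner h)   start        e = ⊥-elim (x-off h (≡-sym e))
      slots (inner h)   (inner h')   e = cong suc (injective p h h' e)
      slots (inner h)   end          e = ⊥-elim (y-off h (≡-sym e))
      slots end         start        e = ⊥-elim (x≢y (≡-sym e))
      slots end         (inner h)    e = ⊥-elim (y-off h e)
      slots end         end          _ = refl

    vertex-inner : ∀ {m} → 0 < m → m < 2 + D → ∃[ r ] vertex m ≡ V r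
    vertex-inner {suc r} _ (s≤s r<1+D) = r , vertex-at (inner (≤-pred r<1+D))

    vertex-end : vertex (toℕ (fromℕ (2 + D))) ≡ y
    vertex-end rewrite toℕ-fromℕ D = vertex-at end

    isPath : IsChordlessPath V D → x ≢ y → OffPath V D x → OffPath V D y →
             x ~ V 0 ≡ true → y ~ V D ≡ true → IsPath G (2 + D) (λ c → vertex (toℕ c))
    isPath p x≢y x-off y-off x-touch y-touch =
      (λ {c} {c'} → vertex-injective p x≢y x-off y-off c c') ,
      λ a → subst (λ m → vertex m ~ vertex (suc (toℕ a)) ≡ true)
                  (≡-sym (toℕ-inject₁ a)) (edge (toℕ<n a))
      where
      edge : ∀ {m} → m < 2 + D → vertex m ~ vertex (suc m) ≡ true
      edge {zero} _ = via-slots start (inner z≤n) x-touch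
      edge {suc r} (s≤s r<1+D) with m≤n⇒m<n∨m≡n (≤-pred r<1+D)
      ... | inj₁ r<D = via-slots (inner (<⇒≤ r<D)) (inner r<D)
                         (trans (adjacency p (<⇒≤ r<D) r<D) (pathAdjℕ-suc r))
      ... | inj₂ refl = via-slots (inner ≤-refl) end (trans (~-sym (V r) y) y-touch)

    isHole : IsChordlessPath V D → 2 ≤ D → Attached V D x 0 → Attached V D y D →
             x ~ y ≡ true → IsInducedHole G (3 + D) (λ c → vertex (toℕ c))
    isHole p 2≤D x-att y-att x~y =
      +-monoʳ-≤ 3 (≤-trans (s≤s z≤n) 2≤D) ,
      (λ {c} {c'} → vertex-injective p x≢y (attached-start-off p 2≤D x-att)
                      (attached-end-off p 2≤D y-att) c c') ,
      λ c c' → via-slots (slotOf c) (slotOf c') (cyclic (slotOf c) (slotOf c'))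
      where
      x≢y : x ≢ y
      x≢y refl with trans (≡-sym x~y) (irrefl G x)
      ... | ()

      flipped : ∀ {m m'} (σ : Slot m) (σ' : Slot m') →
                at σ ~ at σ' ≡ cycAdjℕ (3 + D) m m' → at σ' ~ at σ ≡ cycAdjℕ (3 + D) m' m
      flipped {m} {m'} σ σ' e =
        trans (~-sym (at σ') (at σ)) (trans e (cycAdjℕ-comm (3 + D) m m'))

      start-inner : ∀ {r} (h : r ≤ D) → at start ~ at (inner h) ≡ cycAdjℕ (3 + D) 0 (suc r)
      start-inner h = trans (x-att h) (≡-sym (cycAdjℕ-start-inner h))

      start-end : at start ~ at end ≡ cycAdjℕ (3 + D) 0 (2 + D)
      start-end = trans x~y (≡-sym (cycAdjℕ-start-end D))

      inner-end : ∀ {r} (h : r ≤ D) → at (inner h) ~ at end ≡ cycAdjℕ (3 + D) (suc r) (2 + D)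
      inner-end {r} h = trans (~-sym (V r) y) (trans (y-att h) (≡-sym (cycAdjℕ-inner-end h)))

      cyclic : ∀ {m m'} (σ : Slot m) (σ' : Slot m') → at σ ~ at σ' ≡ cycAdjℕ (3 + D) m m'
      cyclic start       start      = irrefl G x
      cyclic start       (inner h)  = start-inner h
      cyclic start       end        = start-end
      cyclic (inner h)   start      = flipped start (inner h) (start-inner h)
      cyclic (inner {r} h) (inner {r'} h') =
        trans (adjacency p h h') (≡-sym (cycAdjℕ-inner (3 + D) r r'))
      cyclic (inner h)   end        = inner-end h
      cyclic end         start      = flipped start end start-end
      cyclic end         (inner h)  = flipped (inner h) end (inner-end h)
      cyclic end         end        = trans (irrefl G y) (≡-sym (cycAdjℕ-end-end D))

  record PendantPair (V : ℕ → Fin n) (D j : ℕ) : Set where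
    constructor pendants
    field
      first second    : Fin n
      distinct        : first ≢ second
      first-attached  : Attached V D first j
      second-attached : Attached V D second j
  open PendantPair

  wingOf : ∀ {V D} → PendantPair V D 0 → PendantPair V D D → Wing → Fin n
  wingOf L R L₁ = first L
  wingOf L R L₂ = second L
  wingOf L R R₁ = first R
  wingOf L R R₂ = second R

  embedH : ∀ {D} → (ℕ → Fin n) → (Wing → Fin n) → HV D → Fin n
  embedH V F (body j) = V (toℕ j)
  embedH V F (wing w) = F w

  Separated : (Wing → Fin n) → Set
  Separated F = ∀ {w w'} → IsLeft w → IsRight w' → F w ~ F w' ≡ false

  separated? : (F : Wing → Fin n) →
               (Σ Wing λ w → Σ Wing λ w' → IsLeft w × IsRight w' × F w ~ F w' ≡ true)
               ⊎ Separated F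
  separated? F with F L₁ ~ F R₁ in e₁₁ | F L₁ ~ F R₂ in e₁₂
                  | F L₂ ~ F R₁ in e₂₁ | F L₂ ~ F R₂ in e₂₂
  ... | true  | _     | _     | _     = inj₁ (L₁ , R₁ , l₁ , r₁ , e₁₁)
  ... | false | true  | _     | _     = inj₁ (L₁ , R₂ , l₁ , r₂ , e₁₂)
  ... | false | false | true  | _     = inj₁ (L₂ , R₁ , l₂ , r₁ , e₂₁)
  ... | false | false | false | true  = inj₁ (L₂ , R₂ , l₂ , r₂ , e₂₂)
  ... | false | false | false | false =
    inj₂ λ { l₁ r₁ → e₁₁ ; l₁ r₂ → e₁₂ ; l₂ r₁ → e₂₁ ; l₂ r₂ → e₂₂ }

  module _ {V D} (path : IsChordlessPath V D) (2≤D : 2 ≤ D)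
           (L : PendantPair V D 0) (R : PendantPair V D D) where

    private
      F : Wing → Fin n
      F = wingOf L R

      bound : (j : Fin (suc D)) → toℕ j ≤ D
      bound j = ≤-pred (toℕ<n j)

      left-attached : ∀ {w} → IsLeft w → Attached V D (F w) 0
      left-attached l₁ = first-attached L
      left-attached l₂ = second-attached L

      right-attached : ∀ {w} → IsRight w → Attached V D (F w) D
      right-attached r₁ = first-attached R
      right-attached r₂ = second-attached R

      left≢right : ∀ {w w'} → IsLeft w → IsRight w' → F w ≢ F w'
      left≢right l r = ends-distinct (≤-trans (s≤s z≤n) 2≤D) (left-attached l) (right-attached r)

      wing-off : ∀ w → OffPath V D (F w)
      wing-off L₁ = attached-start-off path 2≤D (left-attached l₁)
      wing-off L₂ = attached-start-off path 2≤D (left-attached l₂)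
      wing-off R₁ = attached-end-off path 2≤D (right-attached r₁)
      wing-off R₂ = attached-end-off path 2≤D (right-attached r₂)

      wing-injective : ∀ w w' → F w ≡ F w' → w ≡ w'
      wing-injective L₁ L₁ _ = refl
      wing-injective L₁ L₂ e = ⊥-elim (distinct L e)
      wing-injective L₁ R₁ e = ⊥-elim (left≢right l₁ r₁ e)
      wing-injective L₁ R₂ e = ⊥-elim (left≢right l₁ r₂ e)
      wing-injective L₂ L₁ e = ⊥-elim (distinct L (≡-sym e))
      wing-injective L₂ L₂ _ = refl
      wing-injective L₂ R₁ e = ⊥-elim (left≢right l₂ r₁ e)
      wing-injective L₂ R₂ e = ⊥-elim (left≢right l₂ r₂ e)
      wing-injective R₁ L₁ e = ⊥-elim (left≢right l₁ r₁ (≡-sym e))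
      wing-injective R₁ L₂ e = ⊥-elim (left≢right l₂ r₁ (≡-sym e))
      wing-injective R₁ R₁ _ = refl
      wing-injective R₁ R₂ e = ⊥-elim (distinct R e)
      wing-injective R₂ L₁ e = ⊥-elim (left≢right l₁ r₂ (≡-sym e))
      wing-injective R₂ L₂ e = ⊥-elim (left≢right l₂ r₂ (≡-sym e))
      wing-injective R₂ R₁ e = ⊥-elim (distinct R (≡-sym e))
      wing-injective R₂ R₂ _ = refl

      embedH-injective : Injective _≡_ _≡_ (embedH {D} V F)
      embedH-injective {body j} {body k} e =
        cong body (toℕ-injective (injective path (bound j) (bound k) e))
      embedH-injective {body j} {wing w} e = ⊥-elim (wing-off w (bound j) (≡-sym e))
      embedH-injective {wing w} {body j} e = ⊥-elim (wing-off w (bound j) e)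
      embedH-injective {wing w} {wing w'} e = cong wing (wing-injective w w' e)

      wing-body : ∀ w j → F w ~ V (toℕ j) ≡ wingAt D w j
      wing-body L₁ j = left-attached l₁ (bound j)
      wing-body L₂ j = left-attached l₂ (bound j)
      wing-body R₁ j = right-attached r₁ (bound j)
      wing-body R₂ j = right-attached r₂ (bound j)

      wing-wing : Separated F → ∀ w w' → F w ~ F w' ≡ wingAdj (F L₁ ~ F L₂) (F R₁ ~ F R₂) w w'
      wing-wing sep L₁ L₁ = irrefl G (F L₁)
      wing-wing sep L₁ L₂ = refl
      wing-wing sep L₁ R₁ = sep l₁ r₁
      wing-wing sep L₁ R₂ = sep l₁ r₂
      wing-wing sep L₂ L₁ = ~-sym (F L₂) (F L₁)
      wing-wing sep L₂ L₂ = irrefl G (F L₂)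
      wing-wing sep L₂ R₁ = sep l₂ r₁
      wing-wing sep L₂ R₂ = sep l₂ r₂
      wing-wing sep R₁ L₁ = trans (~-sym (F R₁) (F L₁)) (sep l₁ r₁)
      wing-wing sep R₁ L₂ = trans (~-sym (F R₁) (F L₂)) (sep l₂ r₁)
      wing-wing sep R₁ R₁ = irrefl G (F R₁)
      wing-wing sep R₁ R₂ = refl
      wing-wing sep R₂ L₁ = trans (~-sym (F R₂) (F L₁)) (sep l₁ r₂)
      wing-wing sep R₂ L₂ = trans (~-sym (F R₂) (F L₂)) (sep l₂ r₂)
      wing-wing sep R₂ R₁ = ~-sym (F R₂) (F R₁)
      wing-wing sep R₂ R₂ = irrefl G (F R₂)

    embedH-isInducedH : Separated F →
                        IsInducedH G D (F L₁ ~ F L₂) (F R₁ ~ F R₂) (embedH V F)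
    embedH-isInducedH sep = embedH-injective , adjacent
      where
      adjacent : ∀ u v → embedH V F u ~ embedH V F v ≡ HAdj D (F L₁ ~ F L₂) (F R₁ ~ F R₂) u v
      adjacent (body j) (body k) = adjacency path (bound j) (bound k)
      adjacent (body j) (wing w) = trans (~-sym (V (toℕ j)) (F w)) (wing-body w j)
      adjacent (wing w) (body j) = wing-body w j
      adjacent (wing w) (wing w') = wing-wing sep w w'

    hasCanonicalInduced : ∀ {s} → s ≤ D → HasCanonicalInduced G s
    hasCanonicalInduced s≤D with separated? F
    ... | inj₁ (w , w' , l , r , F-w~w') =
      inj₁ (3 + D , _ , ≤-trans s≤D (m≤n+m D 3) ,
            Extension.isHole V D (F w) (F w') path 2≤D (left-attached l) (right-attached r) F-w~w')
    ... | inj₂ sep =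
      inj₂ (D , _ , _ , embedH V F , ≤-trans (s≤s z≤n) 2≤D , ≤-trans s≤D (n≤1+n D) ,
            embedH-isInducedH sep)

module EmbeddedH {n : ℕ} (G : Graph n) (i : ℕ) (lt rt : Bool) (f : HV i → Fin n)
                 (f-injective : Injective _≡_ _≡_ f)
                 (f-edges : ∀ x y → HAdj i lt rt x y ≡ true → adj G (f x) (f y) ≡ true)
                 (chordless : BodyChordless G i f) (s : ℕ) (2≤s : 2 ≤ s) where

  open ChordlessPaths G

  bodyAt : ℕ → Fin n
  bodyAt j = f (body (clamp i j))

  W : Wing → Fin n
  W w = f (wing w)

  body-path : IsChordlessPath bodyAt i
  body-path = record
    { adjacency = λ {r} {r'} h h' →
        trans (chordless (clamp i r) (clamp i r')) (cong₂ pathAdjℕ (toℕ-clamp h) (toℕ-clamp h'))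
    ; injective = λ h h' e →
        trans (≡-sym (toℕ-clamp h)) (trans (cong toℕ (body-injective (f-injective e))) (toℕ-clamp h'))
    }
    where
    body-injective : ∀ {j k} → body {i} j ≡ body k → j ≡ k
    body-injective refl = refl

  wing≢body : ∀ {w} r → W w ≢ bodyAt r
  wing≢body _ e with f-injective e
  ... | ()

  left≢right : ∀ {w w'} → IsLeft w → IsRight w' → W w ≢ W w'
  left≢right l r e with f-injective e
  left≢right l₁ () e | refl
  left≢right l₂ () e | refl

  L₁≢L₂ : W L₁ ≢ W L₂
  L₁≢L₂ e with f-injective e
  ... | ()

  R₁≢R₂ : W R₁ ≢ W R₂
  R₁≢R₂ e with f-injective e
  ... | ()

  left-touches : ∀ {w} → IsLeft w → W w ~ bodyAt 0 ≡ true
  left-touches {w} l = f-edges (wing w) (body (clamp i 0)) (wing-at l)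
    where
    wing-at : IsLeft w → wingAt i w (clamp i 0) ≡ true
    wing-at l₁ = cong (_≡ᵇ 0) (toℕ-clamp {i} z≤n)
    wing-at l₂ = cong (_≡ᵇ 0) (toℕ-clamp {i} z≤n)

  right-touches : ∀ {w} → IsRight w → W w ~ bodyAt i ≡ true
  right-touches {w} r = f-edges (wing w) (body (clamp i i)) (wing-at r)
    where
    wing-at : IsRight w → wingAt i w (clamp i i) ≡ true
    wing-at r₁ = trans (cong (_≡ᵇ i) (toℕ-clamp {i} ≤-refl)) (≡ᵇ-refl i)
    wing-at r₂ = trans (cong (_≡ᵇ i) (toℕ-clamp {i} ≤-refl)) (≡ᵇ-refl i)

  left-end : ∀ {w} → IsLeft w → (W w ≡ f (wing L₁)) ⊎ (W w ≡ f (wing L₂))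
  left-end l₁ = inj₁ refl
  left-end l₂ = inj₂ refl

  right-end : ∀ {w} → IsRight w → (W w ≡ f (wing R₁)) ⊎ (W w ≡ f (wing R₂))
  right-end r₁ = inj₁ refl
  right-end r₂ = inj₂ refl

  touchesLeft touchesRight : ℕ → Bool
  touchesLeft  r = W L₁ ~ bodyAt r ∨ W L₂ ~ bodyAt r
  touchesRight r = W R₁ ~ bodyAt r ∨ W R₂ ~ bodyAt r

  touchesLeft-start : touchesLeft 0 ≡ true
  touchesLeft-start rewrite left-touches l₁ = refl

  touchesRight-end : touchesRight i ≡ true
  touchesRight-end rewrite right-touches r₁ = refl

  left-witness : ∀ r → touchesLeft r ≡ true → Σ Wing λ w → IsLeft w × W w ~ bodyAt r ≡ true
  left-witness r e with W L₁ ~ bodyAt r in e₁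
  ... | true  = L₁ , l₁ , e₁
  ... | false = L₂ , l₂ , e

  right-witness : ∀ r → touchesRight r ≡ true → Σ Wing λ w → IsRight w × W w ~ bodyAt r ≡ true
  right-witness r e with W R₁ ~ bodyAt r in e₁
  ... | true  = R₁ , r₁ , e₁
  ... | false = R₂ , r₂ , e

  left-untouched : ∀ r {w} → touchesLeft r ≡ false → IsLeft w → W w ~ bodyAt r ≡ false
  left-untouched _ e l₁ = ∨-conicalˡ _ _ e
  left-untouched _ e l₂ = ∨-conicalʳ _ _ e

  right-untouched : ∀ r {w} → touchesRight r ≡ false → IsRight w → W w ~ bodyAt r ≡ false
  right-untouched _ e r₁ = ∨-conicalˡ _ _ e
  right-untouched _ e r₂ = ∨-conicalʳ _ _ e

  window : ℕ → ℕ → Fin n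
  window j r = bodyAt (j + r)

  window-path : ∀ {j D} → j + D ≤ i → IsChordlessPath (window j) D
  window-path {j} h = shift j (restrict h body-path)

  window-start : ∀ {a} j → a ~ bodyAt j ≡ true → a ~ window j 0 ≡ true
  window-start {a} j = subst (λ m → a ~ bodyAt m ≡ true) (≡-sym (+-identityʳ j))

  wing-off-window : ∀ j D w → OffPath (window j) D (W w)
  wing-off-window j D w {r} _ = wing≢body (j + r)

  NoLeftAfter : ℕ → ℕ → Set
  NoLeftAfter j k = ∀ {r} → j < r → r ≤ k → touchesLeft r ≡ false

  NoRightBefore : ℕ → Set
  NoRightBefore k = ∀ {r} → r < k → touchesRight r ≡ false

  left-attached-window : ∀ {j D w} → IsLeft w → W w ~ bodyAt j ≡ true →
                         NoLeftAfter j (j + D) → Attached (window j) D (W w) 0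
  left-attached-window {j} {D} {w} l touch above =
    attached-start {window j} {D} (window-start j touch) λ {r} 0<r r≤D →
      left-untouched (j + r) (above (m<m+n j 0<r) (+-monoʳ-≤ j r≤D)) l

  right-attached-window : ∀ {j D w} → IsRight w → W w ~ bodyAt (j + D) ≡ true →
                          NoRightBefore (j + D) → Attached (window j) D (W w) D
  right-attached-window {j} {D} right touch below =
    attached-end {window j} {D} touch λ {r} r<D →
      right-untouched (j + r) (below (+-monoʳ-< j r<D)) right

  left-pendants : ∀ j D {x} → j + D ≤ i → IsLeft x → W x ~ bodyAt j ≡ true →
                  NoLeftAfter j (j + D) → PendantPair (window j) D 0
  left-pendants zero D _ _ _ above =
    pendants (W L₁) (W L₂) L₁≢L₂ (left-attached-window l₁ (left-touches l₁) above)
                                 (left-attached-window l₂ (left-touches l₂) above)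
  left-pendants (suc j) D {x} h x-left x-touch above =
    pendants (W x) (bodyAt j) (wing≢body j) (left-attached-window x-left x-touch above)
                                            (predecessor-attached body-path h)

  right-pendants : ∀ j D {y} → j + D ≤ i → IsRight y → W y ~ bodyAt (j + D) ≡ true →
                   NoRightBefore (j + D) → PendantPair (window j) D D
  right-pendants j D {y} h y-right y-touch below with m≤n⇒m<n∨m≡n h
  ... | inj₁ j+D<i =
    pendants (W y) (bodyAt (suc (j + D))) (wing≢body (suc (j + D)))
             (right-attached-window y-right y-touch below) (successor-attached body-path j+D<i)
  ... | inj₂ j+D≡i =
    pendants (W R₁) (W R₂) R₁≢R₂ (right-attached-window r₁ (touch r₁) below)
                                 (right-attached-window r₂ (touch r₂) below)
    where
    touch : ∀ {w} → IsRight w → W w ~ bodyAt (j + D) ≡ true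
    touch {w} r = subst (λ m → W w ~ bodyAt m ≡ true) (≡-sym j+D≡i) (right-touches r)

  wing-path : ∀ j D {x y} → j + D ≤ i → IsLeft x → IsRight y →
              W x ~ bodyAt j ≡ true → W y ~ bodyAt (j + D) ≡ true → suc D ≤ s →
              HasWingPath G i f s
  wing-path j D {x} {y} h x-left y-right x-touch y-touch 1+D≤s =
    2 + D , (λ c → vertex (toℕ c)) , s≤s (s≤s z≤n) , s≤s 1+D≤s ,
    isPath (window-path h) (left≢right x-left y-right) (wing-off-window j D x)
           (wing-off-window j D y) (window-start j x-touch) y-touch ,
    left-end x-left ,
    subst (λ v → (v ≡ f (wing R₁)) ⊎ (v ≡ f (wing R₂))) (≡-sym vertex-end) (right-end y-right) ,
    λ a 0<a a<2+D → let (r , e) = vertex-inner 0<a a<2+D in clamp i (j + r) , e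
    where open Extension (window j) D (W x) (W y)

  window-outcome : ∀ j D {x y} → j + D ≤ i → IsLeft x → IsRight y →
                   W x ~ bodyAt j ≡ true → W y ~ bodyAt (j + D) ≡ true →
                   NoLeftAfter j (j + D) → NoRightBefore (j + D) →
                   HasWingPath G i f s ⊎ HasCanonicalInduced G s
  window-outcome j D h x-left y-right x-touch y-touch above below with suc D ≤? s
  ... | yes 1+D≤s = inj₁ (wing-path j D h x-left y-right x-touch y-touch 1+D≤s)
  ... | no 1+D≰s =
    inj₂ (hasCanonicalInduced (window-path h) (≤-trans 2≤s s≤D)
                              (left-pendants j D h x-left x-touch above)
                              (right-pendants j D h y-right y-touch below) s≤D)
    where
    s≤D : s ≤ D
    s≤D = ≤-pred (≰⇒> 1+D≰s)

  wingPath-or-canonical : HasWingPath G i f s ⊎ HasCanonicalInduced G s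
  wingPath-or-canonical with first-true touchesRight i touchesRight-end
  ... | k , k≤i , k-touched , below
    with right-witness k k-touched | last-true touchesLeft k touchesLeft-start
  ... | y , y-right , y-touch | j , j≤k , j-touched , above
    with left-witness j j-touched | m≤n⇒∃[o]m+o≡n j≤k
  ... | x , x-left , x-touch | D , refl =
    window-outcome j D k≤i x-left y-right x-touch y-touch above below

lemma3 : {n : ℕ} (G : Graph n) (i : ℕ) (lt rt : Bool) (f : HV i → Fin n) →
    1 ≤ i → IsHSubgraph G i lt rt f → BodyChordless G i f →
    (s : ℕ) → 2 ≤ s →
    HasWingPath G i f s ⊎ HasCanonicalInduced G s
lemma3 G i lt rt f _ (f-injective , f-edges) chordless s 2≤s =
  EmbeddedH.wingPath-or-canonical G i lt rt f f-injective f-edges chordless s 2≤s
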